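{- Let $\ell \geq 2$ be an integer. A graph $G$ is an $\mathcal{L}_\ell$-cluster graph if and only if $G$ contains none of the graphs $P_4$, $\overline{P_3 \cup K_1}$ (the paw) and $K_{\ell+2}-e$ as an induced subgraph.
   Context: All graphs are finite, simple and undirected. A clique is a complete graph; for $\ell \geq 2$, an $\ell$-clique is a connected complete $\ell$-partite graph. An $\mathcal{L}_\ell$-cluster graph is a graph each of whose connected components is a clique or an $\ell$-clique. $P_4$ is the chordless path on $4$ vertices, $\overline{P_3 \cup K_1}$ is the complement of the disjoint union of a path on 3 vertices and a single vertex, and $K_{\ell+2}-e$ is the complete graph on $\ell+2$ vertices with one edge removed. -}

module Defs where

open import Data.Nat using (ℕ; zero; suc; _+_; _≤?_)
open import Data.Fin using (Fin; zero; suc; toℕ; _≟_)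
open import Data.Bool using (Bool; true; false; not; _∧_)
open import Data.Bool.Properties using (∧-comm)
open import Data.Product using (Σ; _×_)
open import Data.Sum using (_⊎_)
open import Relation.Nullary using (¬_; yes; no)
open import Relation.Nullary.Decidable using (⌊_⌋)
open import Relation.Binary.PropositionalEquality using (_≡_; refl; _≢_; sym; cong₂)
open import Function.Definitions using (Injective)
open import Function.Bundles using (_⇔_)

record Graph : Set where
  field
    n      : ℕ
    adj    : Fin n → Fin n → Bool
    adj-sym     : ∀ i j → adj i j ≡ adj j i
    adj-irrefl  : ∀ i → adj i i ≡ false
open Graph public

InducedSubgraph : Graph → Graph → Set
InducedSubgraph H G =
  Σ (Fin (n H) → Fin (n G)) λ f →
    Injective _≡_ _≡_ f × (∀ i j → adj G (f i) (f j) ≡ adj H i j)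

data Reach (G : Graph) : Fin (n G) → Fin (n G) → Set where
  here  : ∀ {u} → Reach G u u
  there : ∀ {u w v} → adj G u w ≡ true → Reach G w v → Reach G u v

ComponentIsClique : (G : Graph) → Fin (n G) → Set
ComponentIsClique G v =
  ∀ x y → Reach G v x → Reach G v y → x ≢ y → adj G x y ≡ true

-- The component of v induces a complete ℓ-partite graph: there is a
-- partition of its vertices into ℓ classes (given by c, classes may be empty)
-- such that two vertices are adjacent iff they lie in different classes.
-- (Connectedness is automatic for a component.)
ComponentIsLClique : ℕ → (G : Graph) → Fin (n G) → Set
ComponentIsLClique ℓ G v =
  Σ (Fin (n G) → Fin ℓ) λ c →
    ∀ x y → Reach G v x → Reach G v y → (adj G x y ≡ true ⇔ c x ≢ c y)

IsLClusterGraph : ℕ → Graph → Set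
IsLClusterGraph ℓ G =
  ∀ v → ComponentIsClique G v ⊎ ComponentIsLClique ℓ G v

p4adj : Fin 4 → Fin 4 → Bool
p4adj zero (suc zero) = true
p4adj (suc zero) zero = true
p4adj (suc zero) (suc (suc zero)) = true
p4adj (suc (suc zero)) (suc zero) = true
p4adj (suc (suc zero)) (suc (suc (suc zero))) = true
p4adj (suc (suc (suc zero))) (suc (suc zero)) = true
p4adj _ _ = false

P4 : Graph
P4 = record { n = 4 ; adj = p4adj ; adj-sym = s ; adj-irrefl = r }
  where
  s : ∀ i j → p4adj i j ≡ p4adj j i
  s zero zero = refl
  s zero (suc zero) = refl
  s zero (suc (suc zero)) = refl
  s zero (suc (suc (suc zero))) = refl
  s (suc zero) zero = refl
  s (suc zero) (suc zero) = refl
  s (suc zero) (suc (suc zero)) = refl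
  s (suc zero) (suc (suc (suc zero))) = refl
  s (suc (suc zero)) zero = refl
  s (suc (suc zero)) (suc zero) = refl
  s (suc (suc zero)) (suc (suc zero)) = refl
  s (suc (suc zero)) (suc (suc (suc zero))) = refl
  s (suc (suc (suc zero))) zero = refl
  s (suc (suc (suc zero))) (suc zero) = refl
  s (suc (suc (suc zero))) (suc (suc zero)) = refl
  s (suc (suc (suc zero))) (suc (suc (suc zero))) = refl
  r : ∀ i → p4adj i i ≡ false
  r zero = refl
  r (suc zero) = refl
  r (suc (suc zero)) = refl
  r (suc (suc (suc zero))) = refl

-- Paw = complement of P3 ∪ K1, where P3 is 0 - 1 - 2 and 3 is isolated.
-- Adjacency: distinct and not an edge of P3 ∪ K1, i.e. edges 02, 03, 13, 23.
p3k1adj : Fin 4 → Fin 4 → Bool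
p3k1adj zero (suc zero) = true
p3k1adj (suc zero) zero = true
p3k1adj (suc zero) (suc (suc zero)) = true
p3k1adj (suc (suc zero)) (suc zero) = true
p3k1adj _ _ = false

pawadj : Fin 4 → Fin 4 → Bool
pawadj i j = not ⌊ i ≟ j ⌋ ∧ not (p3k1adj i j)

Paw : Graph
Paw = record { n = 4 ; adj = pawadj ; adj-sym = s ; adj-irrefl = r }
  where
  s : ∀ i j → pawadj i j ≡ pawadj j i
  s zero zero = refl
  s zero (suc zero) = refl
  s zero (suc (suc zero)) = refl
  s zero (suc (suc (suc zero))) = refl
  s (suc zero) zero = refl
  s (suc zero) (suc zero) = refl
  s (suc zero) (suc (suc zero)) = refl
  s (suc zero) (suc (suc (suc zero))) = refl
  s (suc (suc zero)) zero = refl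
  s (suc (suc zero)) (suc zero) = refl
  s (suc (suc zero)) (suc (suc zero)) = refl
  s (suc (suc zero)) (suc (suc (suc zero))) = refl
  s (suc (suc (suc zero))) zero = refl
  s (suc (suc (suc zero))) (suc zero) = refl
  s (suc (suc (suc zero))) (suc (suc zero)) = refl
  s (suc (suc (suc zero))) (suc (suc (suc zero))) = refl
  r : ∀ i → pawadj i i ≡ false
  r zero = refl
  r (suc zero) = refl
  r (suc (suc zero)) = refl
  r (suc (suc (suc zero))) = refl

kmeadj : (m : ℕ) → Fin m → Fin m → Bool
kmeadj m i j = not ⌊ i ≟ j ⌋ ∧ not (⌊ toℕ i ≤? 1 ⌋ ∧ ⌊ toℕ j ≤? 1 ⌋)

private
  ≟-sym : ∀ {m} (i j : Fin m) → ⌊ i ≟ j ⌋ ≡ ⌊ j ≟ i ⌋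
  ≟-sym i j with i ≟ j | j ≟ i
  ... | yes _ | yes _ = refl
  ... | no _  | no _  = refl
  ... | yes p | no q  = Data.Empty.⊥-elim (q (sym p))
    where import Data.Empty
  ... | no p  | yes q = Data.Empty.⊥-elim (p (sym q))
    where import Data.Empty

  ≟-refl : ∀ {m} (i : Fin m) → ⌊ i ≟ i ⌋ ≡ true
  ≟-refl i with i ≟ i
  ... | yes _ = refl
  ... | no p  = Data.Empty.⊥-elim (p refl)
    where import Data.Empty

KminusE : ℕ → Graph
KminusE m = record { n = m ; adj = kmeadj m ; adj-sym = s ; adj-irrefl = r }
  where
  s : ∀ i j → kmeadj m i j ≡ kmeadj m j i
  s i j = cong₂ (λ a b → not a ∧ not b) (≟-sym i j)
            (∧-comm ⌊ toℕ i ≤? 1 ⌋ ⌊ toℕ j ≤? 1 ⌋)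
  r : ∀ i → kmeadj m i i ≡ false
  r i rewrite ≟-refl i = refl

-- Both sides say that in every component non-adjacency is transitive and no
-- component contains a non-edge together with an (ℓ+1)-clique.  In a complete
-- ℓ-partite component non-adjacency means "same part", which is transitive (this
-- excludes P4 and the paw) and bounds cliques by ℓ (pigeonhole).  Conversely, in a
-- P4- and paw-free graph the neighbourhood of an edge is closed under adjacency,
-- hence is the whole component, and non-adjacency is transitive there; so the
-- component is a clique or complete multipartite.  Choosing part representatives
-- greedily, ℓ+1 parts plus a non-edge would span an induced K_{ℓ+2} − e.

module Submission where

open import Defs
open import Data.Nat using (ℕ; zero; suc; _≤_; _+_; s≤s; s≤s⁻¹)
open import Data.Nat.Properties using (+-comm; n<1+n; ≰⇒>; _≤?_)
open import Data.Fin using (Fin; zero; suc; _≟_; _<_; punchIn; inject≤; #_)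
open import Data.Fin.Properties
  using (any?; all?; <-cmp; <⇒≢; pigeonhole; punchInᵢ≢i; punchIn-injective; inject≤-injective)
open import Data.Bool using (true; false)
import Data.Bool.Properties as Bool
open import Data.List using (List; []; _∷_; length; lookup; allFin)
open import Data.List.Relation.Unary.All using (All; []; _∷_)
import Data.List.Relation.Unary.All as All
open import Data.List.Relation.Unary.All.Properties using (¬Any⇒All¬)
open import Data.List.Relation.Unary.Any using (Any; here; there; index)
import Data.List.Relation.Unary.Any as Any
open import Data.List.Relation.Unary.Any.Properties using (lookup-index)
open import Data.List.Relation.Unary.AllPairs using (AllPairs; []; _∷_)
open import Data.List.Membership.Propositional using (_∈_)
open import Data.List.Membership.Propositional.Properties using (∈-allFin; ∈-lookup)
open import Data.Product using (Σ; _×_; _,_; proj₁; proj₂)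
open import Data.Sum using (_⊎_; inj₁; inj₂)
open import Data.Empty using (⊥; ⊥-elim)
open import Relation.Nullary using (¬_; Dec; yes; no; contradiction)
open import Relation.Nullary.Decidable using (_×-dec_; _⊎-dec_; _→-dec_; ¬?; from-yes; decidable-stable)
open import Relation.Binary using (Rel; Decidable; Symmetric; IsPartialEquivalence; tri<; tri≈; tri>)
open import Relation.Binary.PropositionalEquality
open import Level using (0ℓ)
open import Function using (_∘_)
open import Function.Bundles using (_⇔_; mk⇔; Equivalence)
open import Function.Definitions using (Injective)

-- Classes of a decidable partial equivalence relation

lookup-pairwise : ∀ {a r} {A : Set a} {R : Rel A r} → Symmetric R → ∀ {xs} → AllPairs R xs →
                  ∀ i j → i ≢ j → R (lookup xs i) (lookup xs j)
lookup-pairwise R-sym (_ ∷ _)     zero    zero    i≢j = contradiction refl i≢j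
lookup-pairwise R-sym (Rx ∷ _)    zero    (suc j) _   = All.lookup Rx (∈-lookup j)
lookup-pairwise R-sym (Rx ∷ _)    (suc i) zero    _   = R-sym (All.lookup Rx (∈-lookup i))
lookup-pairwise R-sym (_ ∷ Rxs)   (suc i) (suc j) i≢j = lookup-pairwise R-sym Rxs i j (i≢j ∘ cong suc)

module PartialEquivalenceClasses {n r} {_≈_ : Rel (Fin n) r}
         (_≈?_ : Decidable _≈_) (isPER : IsPartialEquivalence _≈_) where
  open IsPartialEquivalence isPER renaming (sym to ≈-sym; trans to ≈-trans)

  ≉-sym : Symmetric (λ x y → ¬ x ≈ y)
  ≉-sym x≉y y≈x = x≉y (≈-sym y≈x)

  PairwiseInequivalent : ∀ {m} → (Fin m → Fin n) → Set r
  PairwiseInequivalent x = (∀ i → x i ≈ x i) × (∀ i j → i ≢ j → ¬ x i ≈ x j)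

  representatives : List (Fin n) → List (Fin n)
  representatives []       = []
  representatives (x ∷ xs) with x ≈? x | Any.any? (x ≈?_) (representatives xs)
  ... | yes _ | no _ = x ∷ representatives xs
  ... | yes _ | yes _ = representatives xs
  ... | no _  | _     = representatives xs

  representatives-inDomain : ∀ xs → All (λ r → r ≈ r) (representatives xs)
  representatives-inDomain []       = []
  representatives-inDomain (x ∷ xs) with x ≈? x | Any.any? (x ≈?_) (representatives xs)
  ... | yes x≈x | no _ = x≈x ∷ representatives-inDomain xs
  ... | yes _   | yes _ = representatives-inDomain xs
  ... | no _    | _     = representatives-inDomain xs

  representatives-inequivalent : ∀ xs → AllPairs (λ r s → ¬ r ≈ s) (representatives xs)
  representatives-inequivalent []       = []
  representatives-inequivalent (x ∷ xs) with x ≈? x | Any.any? (x ≈?_) (representatives xs)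
  ... | yes _ | no x≉reps = ¬Any⇒All¬ _ x≉reps ∷ representatives-inequivalent xs
  ... | yes _ | yes _     = representatives-inequivalent xs
  ... | no _  | _         = representatives-inequivalent xs

  representatives-cover : ∀ {x} xs → x ∈ xs → x ≈ x → Any (x ≈_) (representatives xs)
  representatives-cover (y ∷ ys) x∈ x≈x with y ≈? y | Any.any? (y ≈?_) (representatives ys)
  representatives-cover (y ∷ ys) (here refl) x≈x | yes _ | no _     = here x≈x
  representatives-cover (y ∷ ys) (there x∈)  x≈x | yes _ | no _     = there (representatives-cover ys x∈ x≈x)
  representatives-cover (y ∷ ys) (here refl) x≈x | yes _ | yes y≈r  = y≈r
  representatives-cover (y ∷ ys) (there x∈)  x≈x | yes _ | yes _    = representatives-cover ys x∈ x≈x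
  representatives-cover (y ∷ ys) (here refl) x≈x | no y≉y | _       = contradiction x≈x y≉y
  representatives-cover (y ∷ ys) (there x∈)  x≈x | no _   | _       = representatives-cover ys x∈ x≈x

  reps : List (Fin n)
  reps = representatives (allFin n)

  reps-cover : ∀ {x} → x ≈ x → Any (x ≈_) reps
  reps-cover {x} = representatives-cover (allFin n) (∈-allFin x)

  reps-length : ∀ ℓ → ¬ Σ (Fin (suc ℓ) → Fin n) PairwiseInequivalent → length reps ≤ ℓ
  reps-length ℓ noFamily with length reps ≤? ℓ
  ... | yes short = short
  ... | no long = contradiction (family , inDomain , inequivalent) noFamily
    where
    ℓ<length : suc ℓ ≤ length reps
    ℓ<length = ≰⇒> long
    family : Fin (suc ℓ) → Fin n
    family i = lookup reps (inject≤ i ℓ<length)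
    inDomain : ∀ i → family i ≈ family i
    inDomain i = All.lookup (representatives-inDomain (allFin n)) (∈-lookup _)
    inequivalent : ∀ i j → i ≢ j → ¬ family i ≈ family j
    inequivalent i j i≢j = lookup-pairwise ≉-sym
      (representatives-inequivalent (allFin n)) _ _ (i≢j ∘ inject≤-injective _ _ i j)

  module _ {x₀} (x₀≈x₀ : x₀ ≈ x₀) where

    classOf : Fin n → Fin (length reps)
    classOf x with Any.any? (x ≈?_) reps
    ... | yes x≈r = index x≈r
    ... | no _    = index (reps-cover x₀≈x₀)  -- junk value outside the domain of ≈

    classOf-sound : ∀ {x} → x ≈ x → x ≈ lookup reps (classOf x)
    classOf-sound {x} x≈x with Any.any? (x ≈?_) reps
    ... | yes x≈r = lookup-index x≈r
    ... | no x≉r  = contradiction (reps-cover x≈x) x≉r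

    ≈⇔sameClass : ∀ {x y} → x ≈ x → y ≈ y → x ≈ y ⇔ classOf x ≡ classOf y
    ≈⇔sameClass {x} {y} x≈x y≈y = mk⇔
      (λ x≈y → decidable-stable (classOf x ≟ classOf y) λ cx≢cy →
         lookup-pairwise ≉-sym (representatives-inequivalent (allFin n)) _ _ cx≢cy
           (≈-trans (≈-sym (classOf-sound x≈x)) (≈-trans x≈y (classOf-sound y≈y))))
      (λ cx≡cy → ≈-trans (classOf-sound x≈x)
                   (≈-sym (subst (λ k → y ≈ lookup reps k) (sym cx≡cy) (classOf-sound y≈y))))

  classify : ∀ ℓ {x₀} → x₀ ≈ x₀ → ¬ Σ (Fin (suc ℓ) → Fin n) PairwiseInequivalent →
             Σ (Fin n → Fin ℓ) λ c → ∀ {x y} → x ≈ x → y ≈ y → x ≈ y ⇔ c x ≡ c y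
  classify ℓ x₀≈x₀ noFamily = c , λ x≈x y≈y → let open Equivalence (≈⇔sameClass x₀≈x₀ x≈x y≈y) in
    mk⇔ (cong (λ k → inject≤ k short) ∘ to) (from ∘ inject≤-injective short short _ _)
    where
    short : length reps ≤ ℓ
    short = reps-length ℓ noFamily
    c : Fin n → Fin ℓ
    c x = inject≤ (classOf x₀≈x₀ x) short

-- Graphs and induced subgraphs

module GraphFacts (G : Graph) where

  adj-flip : ∀ {x y b} → adj G x y ≡ b → adj G y x ≡ b
  adj-flip {x} {y} e = trans (adj-sym G y x) e

  adjacent⇒≢ : ∀ {x y} → adj G x y ≡ true → x ≢ y
  adjacent⇒≢ {x} e refl = Bool.not-¬ e (adj-irrefl G x)

  reach-snoc : ∀ {u w v} → Reach G u w → adj G w v ≡ true → Reach G u v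
  reach-snoc here        e = there e here
  reach-snoc (there d r) e = there d (reach-snoc r e)

  reach-sym : ∀ {u v} → Reach G u v → Reach G v u
  reach-sym here        = here
  reach-sym (there e r) = reach-snoc (reach-sym r) (adj-flip e)

  reach-trans : ∀ {u v w} → Reach G u v → Reach G v w → Reach G u w
  reach-trans here        r′ = r′
  reach-trans (there e r) r′ = there e (reach-trans r r′)

  reach-closed : (S : Fin (n G) → Set) → (∀ {p q} → S p → adj G p q ≡ true → S q) →
                 ∀ {u v} → S u → Reach G u v → S v
  reach-closed S step su here        = su
  reach-closed S step su (there e r) = reach-closed S step (step su e) r

IsClique : (G : Graph) {m : ℕ} → (Fin m → Fin (n G)) → Set
IsClique G x = ∀ i j → i ≢ j → adj G (x i) (x j) ≡ true

TwinFree : Graph → Set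
TwinFree H = ∀ i j → (∀ k → adj H i k ≡ adj H j k) → i ≡ j

twinFree? : (H : Graph) → Dec (TwinFree H)
twinFree? H = all? λ i → all? λ j → all? (λ k → adj H i k Bool.≟ adj H j k) →-dec i ≟ j

P4-twinFree : TwinFree P4
P4-twinFree = from-yes (twinFree? P4)

Paw-twinFree : TwinFree Paw
Paw-twinFree = from-yes (twinFree? Paw)

module _ (H G : Graph) (f : Fin (n H) → Fin (n G)) where

  AdjacencyPreserving : Set
  AdjacencyPreserving = ∀ i j → adj G (f i) (f j) ≡ adj H i j

  open GraphFacts G using (adj-flip)

  preserving-from-upper : (∀ i j → i < j → adj G (f i) (f j) ≡ adj H i j) → AdjacencyPreserving
  preserving-from-upper upper i j with <-cmp i j
  ... | tri< i<j _ _ = upper i j i<j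
  ... | tri≈ _ refl _ = trans (adj-irrefl G (f i)) (sym (adj-irrefl H i))
  ... | tri> _ _ j<i = trans (adj-flip (upper j i j<i)) (adj-sym H j i)

  twinFree-injective : TwinFree H → AdjacencyPreserving → Injective _≡_ _≡_ f
  twinFree-injective twinFree pres {i} {j} fi≡fj = twinFree i j λ k → begin
    adj H i k         ≡⟨ pres i k ⟨
    adj G (f i) (f k) ≡⟨ cong (λ u → adj G u (f k)) fi≡fj ⟩
    adj G (f j) (f k) ≡⟨ pres j k ⟩
    adj H j k         ∎
    where open ≡-Reasoning

KminusE-clique : ∀ {m} (i j : Fin (suc m)) → i ≢ j → kmeadj (2 + m) (suc i) (suc j) ≡ true
KminusE-clique zero    zero    i≢j = contradiction refl i≢j
KminusE-clique zero    (suc j) _   = refl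
KminusE-clique (suc i) zero    _   = refl
KminusE-clique (suc i) (suc j) i≢j with i ≟ j
... | yes refl = contradiction refl i≢j
... | no _     = refl

module Embeddings (G : Graph) where
  open GraphFacts G

  P4-embedding : ∀ {p q r s} → adj G p q ≡ true → adj G q r ≡ true → adj G r s ≡ true →
                 adj G p r ≡ false → adj G q s ≡ false → adj G p s ≡ false → InducedSubgraph P4 G
  P4-embedding {p} {q} {r} {s} pq qr rs pr qs ps =
    f , twinFree-injective P4 G f P4-twinFree pres , pres
    where
    f : Fin 4 → Fin (n G)
    f zero                   = p
    f (suc zero)             = q
    f (suc (suc zero))       = r
    f (suc (suc (suc zero))) = s
    upper : ∀ i j → i < j → adj G (f i) (f j) ≡ p4adj i j
    upper zero (suc zero)                   _ = pq
    upper zero (suc (suc zero))             _ = pr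
    upper zero (suc (suc (suc zero)))       _ = ps
    upper (suc zero) (suc (suc zero))       _ = qr
    upper (suc zero) (suc (suc (suc zero))) _ = qs
    upper (suc (suc zero)) (suc (suc (suc zero))) _ = rs
    upper _ zero ()
    upper (suc _) (suc zero) (s≤s ())
    upper (suc (suc _)) (suc (suc zero)) (s≤s (s≤s ()))
    upper (suc (suc (suc _))) (suc (suc (suc zero))) (s≤s (s≤s (s≤s ())))
    pres : AdjacencyPreserving P4 G f
    pres = preserving-from-upper P4 G f upper

  Paw-embedding : ∀ {c p x z} → adj G c p ≡ true → adj G c x ≡ true → adj G c z ≡ true →
                  adj G x z ≡ true → adj G p x ≡ false → adj G p z ≡ false → InducedSubgraph Paw G
  Paw-embedding {c} {p} {x} {z} cp cx cz xz px pz =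
    f , twinFree-injective Paw G f Paw-twinFree pres , pres
    where
    f : Fin 4 → Fin (n G)
    f zero                   = x
    f (suc zero)             = p
    f (suc (suc zero))       = z
    f (suc (suc (suc zero))) = c
    upper : ∀ i j → i < j → adj G (f i) (f j) ≡ pawadj i j
    upper zero (suc zero)                   _ = adj-flip px
    upper zero (suc (suc zero))             _ = xz
    upper zero (suc (suc (suc zero)))       _ = adj-flip cx
    upper (suc zero) (suc (suc zero))       _ = pz
    upper (suc zero) (suc (suc (suc zero))) _ = adj-flip cp
    upper (suc (suc zero)) (suc (suc (suc zero))) _ = adj-flip cz
    upper _ zero ()
    upper (suc _) (suc zero) (s≤s ())
    upper (suc (suc _)) (suc (suc zero)) (s≤s (s≤s ()))
    upper (suc (suc (suc _))) (suc (suc (suc zero))) (s≤s (s≤s (s≤s ())))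
    pres : AdjacencyPreserving Paw G f
    pres = preserving-from-upper Paw G f upper

  KminusE-embedding : ∀ {m} (a : Fin (n G)) (x : Fin (suc m) → Fin (n G)) → IsClique G x →
                      a ≢ x zero → adj G a (x zero) ≡ false → (∀ i → adj G a (x (suc i)) ≡ true) →
                      InducedSubgraph (KminusE (2 + m)) G
  KminusE-embedding {m} a x clique a≢x₀ a≁x₀ a~x = f , injective , pres
    where
    f : Fin (2 + m) → Fin (n G)
    f zero    = a
    f (suc i) = x i
    upper : ∀ i j → i < j → adj G (f i) (f j) ≡ kmeadj (2 + m) i j
    upper zero    (suc zero)    _   = a≁x₀
    upper zero    (suc (suc k)) _   = a~x k
    upper (suc i) (suc j)       i<j =
      trans (clique i j (<⇒≢ (s≤s⁻¹ i<j))) (sym (KminusE-clique i j (<⇒≢ (s≤s⁻¹ i<j))))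
    upper _ zero ()
    pres : AdjacencyPreserving (KminusE (2 + m)) G f
    pres = preserving-from-upper (KminusE (2 + m)) G f upper
    injective : Injective _≡_ _≡_ f
    injective {zero}        {zero}        _ = refl
    injective {zero}        {suc zero}    e = contradiction e a≢x₀
    injective {zero}        {suc (suc k)} e = contradiction e (adjacent⇒≢ (a~x k))
    injective {suc zero}    {zero}        e = contradiction (sym e) a≢x₀
    injective {suc (suc k)} {zero}        e = contradiction (sym e) (adjacent⇒≢ (a~x k))
    injective {suc i}       {suc j}       e with i ≟ j
    ... | yes refl = refl
    ... | no i≢j   = contradiction e (adjacent⇒≢ (clique i j i≢j))

-- Transitivity of non-adjacency

NonAdjacencyTransitive : Graph → Set
NonAdjacencyTransitive G = ∀ {v x y z} → Reach G v x → Reach G v y → Reach G v z →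
  adj G x y ≡ false → adj G y z ≡ false → adj G x z ≡ false

module _ {G : Graph} where

  clique-nonadjacent⇒≡ : ∀ {v x y} → ComponentIsClique G v → Reach G v x → Reach G v y →
                         adj G x y ≡ false → x ≡ y
  clique-nonadjacent⇒≡ {x = x} {y} clique rx ry x≁y with x ≟ y
  ... | yes x≡y = x≡y
  ... | no x≢y  = contradiction x≁y (Bool.not-¬ (clique x y rx ry x≢y))

  nonadjacent⇔sameClass : ∀ {ℓ v} ((c , parts) : ComponentIsLClique ℓ G v) → ∀ {x y} →
                          Reach G v x → Reach G v y → adj G x y ≡ false ⇔ c x ≡ c y
  nonadjacent⇔sameClass (c , parts) {x} {y} rx ry = mk⇔
    (λ x≁y → decidable-stable (c x ≟ c y) λ cx≢cy →
       Bool.not-¬ (Equivalence.from (parts x y rx ry) cx≢cy) x≁y)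
    (λ cx≡cy → Bool.¬-not λ x~y → Equivalence.to (parts x y rx ry) x~y cx≡cy)

  cluster⇒≁-transitive : ∀ {ℓ} → IsLClusterGraph ℓ G → NonAdjacencyTransitive G
  cluster⇒≁-transitive cluster {v} rx ry rz x≁y y≁z with cluster v
  ... | inj₁ clique rewrite clique-nonadjacent⇒≡ clique rx ry x≁y = y≁z
  ... | inj₂ parts@(c , _) = Equivalence.from (sameClass rx rz)
    (trans (Equivalence.to (sameClass rx ry) x≁y) (Equivalence.to (sameClass ry rz) y≁z))
    where
    sameClass : ∀ {x y} → Reach G v x → Reach G v y → adj G x y ≡ false ⇔ c x ≡ c y
    sameClass = nonadjacent⇔sameClass parts

  ≁-transitive⇒P4-free : NonAdjacencyTransitive G → ¬ InducedSubgraph P4 G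
  ≁-transitive⇒P4-free ≁-trans (f , _ , pres) =
    Bool.not-¬ (pres (# 1) (# 0)) (≁-trans here r₃ r₀ (pres (# 1) (# 3)) (pres (# 3) (# 0)))
    where
    r₀ : Reach G (f (# 1)) (f (# 0))
    r₀ = there (pres (# 1) (# 0)) here
    r₃ : Reach G (f (# 1)) (f (# 3))
    r₃ = there (pres (# 1) (# 2)) (there (pres (# 2) (# 3)) here)

  ≁-transitive⇒Paw-free : NonAdjacencyTransitive G → ¬ InducedSubgraph Paw G
  ≁-transitive⇒Paw-free ≁-trans (f , _ , pres) =
    Bool.not-¬ (pres (# 0) (# 2)) (≁-trans (r refl) (r refl) (r refl) (pres (# 0) (# 1)) (pres (# 1) (# 2)))
    where
    r : ∀ {i} → pawadj (# 3) i ≡ true → Reach G (f (# 3)) (f i)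
    r {i} centre~i = there (trans (pres (# 3) i) centre~i) here

  cluster-nonEdge⇒¬largeClique : ∀ {ℓ} → IsLClusterGraph ℓ G → ∀ {v a b} →
    Reach G v a → Reach G v b → a ≢ b → adj G a b ≡ false →
    (x : Fin (suc ℓ) → Fin (n G)) → (∀ i → Reach G v (x i)) → ¬ IsClique G x
  cluster-nonEdge⇒¬largeClique {ℓ} cluster {v} ra rb a≢b a≁b x rx clique with cluster v
  ... | inj₁ componentClique = Bool.not-¬ (componentClique _ _ ra rb a≢b) a≁b
  ... | inj₂ parts@(c , _) with pigeonhole (n<1+n ℓ) (c ∘ x)
  ...   | i , j , i<j , cxi≡cxj =
    Bool.not-¬ (clique i j (<⇒≢ i<j)) (Equivalence.from (nonadjacent⇔sameClass parts (rx i) (rx j)) cxi≡cxj)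

  cluster⇒KminusE-free : ∀ {m} → IsLClusterGraph (suc m) G → ¬ InducedSubgraph (KminusE (2 + suc m)) G
  cluster⇒KminusE-free cluster (f , injective , pres) =
    cluster-nonEdge⇒¬largeClique cluster here (r (# 0)) (λ e → 0≢1 (injective e)) (pres (# 0) (# 1))
      (f ∘ suc) r (λ i j i≢j → trans (pres (suc i) (suc j)) (KminusE-clique i j i≢j))
    where
    0≢1 : zero ≢ # 1
    0≢1 ()
    r : ∀ i → Reach G (f zero) (f (suc i))
    r zero    = there (pres (# 0) (# 2)) (there (pres (# 2) (# 1)) here)
    r (suc k) = there (pres zero (suc (suc k))) here

Dominated : (G : Graph) → (x z u : Fin (n G)) → Set
Dominated G x z u = adj G x u ≡ true ⊎ adj G z u ≡ true

module _ {G : Graph} (noP4 : ¬ InducedSubgraph P4 G) (noPaw : ¬ InducedSubgraph Paw G) where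
  open GraphFacts G
  open Embeddings G

  -- An edge leaving the neighbourhood of x z would span an induced paw or P4.
  dominated-closed : ∀ {x z p q} → adj G x z ≡ true → Dominated G x z p → adj G p q ≡ true →
                     Dominated G x z q
  dominated-closed {x} {z} {p} {q} x~z dom p~q with adj G x q in x?q | adj G z q in z?q
  ... | true  | _     = inj₁ refl
  ... | false | true  = inj₂ refl
  ... | false | false = ⊥-elim (escape dom)
    where
    escape : Dominated G x z p → ⊥
    escape (inj₁ x~p) with adj G z p in z?p
    ... | true  = noPaw (Paw-embedding p~q (adj-flip x~p) (adj-flip z?p) x~z (adj-flip x?q) (adj-flip z?q))
    ... | false = noP4 (P4-embedding (adj-flip p~q) (adj-flip x~p) x~z (adj-flip x?q) (adj-flip z?p) (adj-flip z?q))
    escape (inj₂ z~p) with adj G x p in x?p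
    ... | true  = noPaw (Paw-embedding p~q (adj-flip x?p) (adj-flip z~p) x~z (adj-flip x?q) (adj-flip z?q))
    ... | false = noP4 (P4-embedding (adj-flip p~q) (adj-flip z~p) (adj-flip x~z) (adj-flip z?q) (adj-flip x?p) (adj-flip x?q))

  P4-Paw-free⇒≁-transitive : NonAdjacencyTransitive G
  P4-Paw-free⇒≁-transitive {x = x} {y} {z} rx ry _ x≁y y≁z with adj G x z in x?z
  ... | false = refl
  ... | true with reach-closed (Dominated G x z) (dominated-closed x?z) (inj₂ (adj-flip x?z))
                  (reach-trans (reach-sym rx) ry)
  ...   | inj₁ x~y = contradiction x≁y (Bool.not-¬ x~y)
  ...   | inj₂ z~y = contradiction (adj-flip y≁z) (Bool.not-¬ z~y)

module _ {G : Graph} (≁-trans : NonAdjacencyTransitive G) where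
  open GraphFacts G
  open Embeddings G

  nonEdge-largeClique⇒KminusE : ∀ {ℓ v a b} → Reach G v a → Reach G v b → a ≢ b → adj G a b ≡ false →
    (x : Fin (suc ℓ) → Fin (n G)) → (∀ i → Reach G v (x i)) → IsClique G x →
    InducedSubgraph (KminusE (2 + ℓ)) G
  nonEdge-largeClique⇒KminusE {ℓ} {v} {a} {b} ra rb a≢b a≁b x rx clique =
    KminusE-embedding a z z-clique a≢b a≁b a~y
    where
    -- Two vertices of x missed by a would be non-adjacent, so a misses at most one, x s;
    -- dropping it leaves ℓ common neighbours of a and b.
    skip : Σ (Fin (suc ℓ)) λ s → ∀ j → adj G a (x j) ≡ false → j ≡ s
    skip with any? (λ i → adj G a (x i) Bool.≟ false)
    ... | no none = zero , λ j a≁xj → contradiction (j , a≁xj) none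
    ... | yes (i , a≁xi) = i , λ j a≁xj → decidable-stable (j ≟ i) λ j≢i →
          Bool.not-¬ (clique j i j≢i) (≁-trans (rx j) ra (rx i) (adj-flip a≁xj) a≁xi)
    y : Fin ℓ → Fin (n G)
    y = x ∘ punchIn (proj₁ skip)
    a~y : ∀ j → adj G a (y j) ≡ true
    a~y j = Bool.¬-not λ a≁yj → punchInᵢ≢i (proj₁ skip) j (proj₂ skip _ a≁yj)
    b~y : ∀ j → adj G b (y j) ≡ true
    b~y j = Bool.¬-not λ b≁yj → Bool.not-¬ (a~y j) (≁-trans ra rb (rx _) a≁b b≁yj)
    z : Fin (suc ℓ) → Fin (n G)
    z zero    = b
    z (suc j) = y j
    z-clique : IsClique G z
    z-clique zero    zero    i≢j = contradiction refl i≢j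
    z-clique zero    (suc j) _   = b~y j
    z-clique (suc i) zero    _   = adj-flip (b~y i)
    z-clique (suc i) (suc j) i≢j = clique _ _ (i≢j ∘ cong suc ∘ punchIn-injective _ i j)

  -- An edge v w dominates the component of v, which makes membership in it decidable.
  module EdgeComponent {v w} (v~w : adj G v w ≡ true) where

    reach⇒dominated : ∀ {x} → Reach G v x → Dominated G v w x
    reach⇒dominated {x} rx with adj G v x in v?x | adj G w x in w?x
    ... | true  | _     = inj₁ refl
    ... | false | true  = inj₂ refl
    ... | false | false = contradiction (≁-trans here rx (there v~w here) v?x (adj-flip w?x)) (Bool.not-¬ v~w)

    dominated⇒reach : ∀ {x} → Dominated G v w x → Reach G v x
    dominated⇒reach (inj₁ v~x) = there v~x here
    dominated⇒reach (inj₂ w~x) = there v~w (there w~x here)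

    _≈_ : Rel (Fin (n G)) 0ℓ
    x ≈ y = Dominated G v w x × Dominated G v w y × adj G x y ≡ false

    _≈?_ : Decidable _≈_
    x ≈? y = dominated? x ×-dec dominated? y ×-dec adj G x y Bool.≟ false
      where
      dominated? : ∀ u → Dec (Dominated G v w u)
      dominated? u = (adj G v u Bool.≟ true) ⊎-dec (adj G w u Bool.≟ true)

    ≈-isPER : IsPartialEquivalence _≈_
    ≈-isPER = record
      { sym   = λ (dx , dy , x≁y) → dy , dx , adj-flip x≁y
      ; trans = λ (dx , dy , x≁y) (_ , dz , y≁z) →
          dx , dz , ≁-trans (dominated⇒reach dx) (dominated⇒reach dy) (dominated⇒reach dz) x≁y y≁z
      }

    open PartialEquivalenceClasses _≈?_ ≈-isPER

    reach⇒inDomain : ∀ {x} → Reach G v x → x ≈ x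
    reach⇒inDomain {x} rx = reach⇒dominated rx , reach⇒dominated rx , adj-irrefl G x

    nonEdge⇒noLargeFamily : ∀ {ℓ a b} → ¬ InducedSubgraph (KminusE (2 + ℓ)) G → a ≈ b → a ≢ b →
                            ¬ Σ (Fin (suc ℓ) → Fin (n G)) PairwiseInequivalent
    nonEdge⇒noLargeFamily noK (da , db , a≁b) a≢b (x , inDomain , inequivalent) =
      noK (nonEdge-largeClique⇒KminusE (dominated⇒reach da) (dominated⇒reach db) a≢b a≁b x
             (dominated⇒reach ∘ proj₁ ∘ inDomain)
             λ i j i≢j → Bool.¬-not λ xi≁xj →
               inequivalent i j i≢j (proj₁ (inDomain i) , proj₁ (inDomain j) , xi≁xj))

    multipartite : ∀ {ℓ a b} → ¬ InducedSubgraph (KminusE (2 + ℓ)) G → a ≈ b → a ≢ b →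
                   ComponentIsLClique ℓ G v
    multipartite {ℓ} {a} noK a≈b@(da , _) a≢b
      with classify ℓ (da , da , adj-irrefl G a) (nonEdge⇒noLargeFamily noK a≈b a≢b)
    ... | c , classes = c , λ x y rx ry →
      let open Equivalence (classes (reach⇒inDomain rx) (reach⇒inDomain ry)) in
      mk⇔ (λ x~y cx≡cy → Bool.not-¬ x~y (proj₂ (proj₂ (from cx≡cy))))
          (λ cx≢cy → Bool.¬-not λ x≁y → cx≢cy (to (reach⇒dominated rx , reach⇒dominated ry , x≁y)))

    component : ∀ {ℓ} → ¬ InducedSubgraph (KminusE (2 + ℓ)) G →
                ComponentIsClique G v ⊎ ComponentIsLClique ℓ G v
    component noK with any? (λ a → any? (λ b → (a ≈? b) ×-dec ¬? (a ≟ b)))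
    ... | yes (_ , _ , a≈b , a≢b) = inj₂ (multipartite noK a≈b a≢b)
    ... | no noNonEdge = inj₁ λ x y rx ry x≢y → Bool.¬-not λ x≁y →
          noNonEdge (x , y , (reach⇒dominated rx , reach⇒dominated ry , x≁y) , x≢y)

  ≁-transitive⇒cluster : ∀ {ℓ} → ¬ InducedSubgraph (KminusE (2 + ℓ)) G → IsLClusterGraph ℓ G
  ≁-transitive⇒cluster noK v with any? (λ w → adj G v w Bool.≟ true)
  ... | yes (_ , v~w) = EdgeComponent.component v~w noK
  ... | no isolated   = inj₁ λ x y rx ry x≢y → contradiction (trans (only rx) (sym (only ry))) x≢y
    where
    only : ∀ {x} → Reach G v x → x ≡ v
    only here          = refl
    only (there v~u _) = contradiction (_ , v~u) isolated

proposition1 : (ℓ : ℕ) → 2 ≤ ℓ → (G : Graph) →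
    IsLClusterGraph ℓ G ⇔
      (¬ InducedSubgraph P4 G × ¬ InducedSubgraph Paw G
        × ¬ InducedSubgraph (KminusE (ℓ + 2)) G)
proposition1 ℓ@(suc _) (s≤s _) G = mk⇔
  (λ cluster → let ≁-trans = cluster⇒≁-transitive cluster in
    ≁-transitive⇒P4-free ≁-trans , ≁-transitive⇒Paw-free ≁-trans ,
    subst (λ k → ¬ InducedSubgraph (KminusE k) G) (+-comm 2 ℓ) (cluster⇒KminusE-free cluster))
  (λ (noP4 , noPaw , noK) → ≁-transitive⇒cluster (P4-Paw-free⇒≁-transitive noP4 noPaw)
    (subst (λ k → ¬ InducedSubgraph (KminusE k) G) (+-comm ℓ 2) noK))
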